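{- For $n\ge 2$, the reversal map $R:a_1a_2\cdots a_n\mapsto a_na_{n-1}\cdots a_1$, restricted to the set of full permutations of $[n]$, carries indecomposable permutations to decomposable permutations and decomposable permutations to indecomposable permutations.
   Context: $[n]=\{1,\dots,n\}$; permutations are in one-line notation. The permutation matrix of $\pi=a_1\cdots a_n$ has a $1$ in row $n+1-a_j$, column $j$. Bootstrap percolation: a cell is mutable if it contains $0$ and at least two of its orthogonal neighbours (N, S, E, W) contain $1$; mutable cells are changed to $1$ one at a time until none remain (final configuration independent of the order). $\pi$ is full if the final configuration is the all-ones matrix. A permutation $\pi$ of $[n]$ is indecomposable if there is no $1\le k<n$ with $\pi(\{1,\dots,k\})=\{1,\dots,k\}$, and decomposable otherwise. -}

module Defs where

open import Data.Nat using (ℕ; zero; suc; _<_; _≤_)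
open import Data.Fin using (Fin; toℕ; opposite)
open import Data.Fin.Properties using (opposite-involutive)
open import Data.Fin.Permutation using (Permutation′; permutation; _⟨$⟩ʳ_; _∘ₚ_)
open import Data.Product using (_×_; _,_; Σ; ∃)
open import Data.Sum using (_⊎_)
open import Relation.Binary.PropositionalEquality using (_≡_; _≢_)
open import Relation.Nullary using (¬_)

-- Conventions: [n] is represented by Fin n, with the 0-indexed element i
-- standing for i+1.  A permutation of [n] is a stdlib Permutation′ n;
-- its one-line notation a_1 ... a_n is a_{j+1} = π ⟨$⟩ʳ j (shifted by 1).

Cell : ℕ → Set
Cell n = Fin n × Fin n   -- (row , column), both 0-indexed, rows counted from top

Adjacent : ∀ {n} → Cell n → Cell n → Set
Adjacent (r , c) (r' , c') =
  (r ≡ r' × (suc (toℕ c) ≡ toℕ c' ⊎ suc (toℕ c') ≡ toℕ c)) ⊎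
  (c ≡ c' × (suc (toℕ r) ≡ toℕ r' ⊎ suc (toℕ r') ≡ toℕ r))

-- Permutation matrix: a 1 in row n+1-a_j, column j (1-indexed); in 0-indexed
-- terms, row  n - 1 - (π j) = opposite (π j), column j.
HasOne : ∀ {n} → Permutation′ n → Cell n → Set
HasOne π (r , c) = r ≡ opposite (π ⟨$⟩ʳ c)

-- Cells that are 1 in the final configuration of bootstrap percolation:
-- the least set containing the initial 1s and closed under the rule
-- "a cell with at least two (distinct) orthogonal neighbours containing 1
-- becomes 1".
data Infected {n} (π : Permutation′ n) : Cell n → Set where
  initial : ∀ {x} → HasOne π x → Infected π x
  spread  : ∀ {x y z} → Adjacent y x → Adjacent z x → y ≢ z →
            Infected π y → Infected π z → Infected π x

Full : ∀ {n} → Permutation′ n → Set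
Full {n} π = ∀ (x : Cell n) → Infected π x

Decomposable : ∀ {n} → Permutation′ n → Set
Decomposable {n} π = Σ ℕ λ k → 1 ≤ k × k < n ×
  ((∀ (i : Fin n) → toℕ i < k → toℕ (π ⟨$⟩ʳ i) < k) ×
   (∀ (j : Fin n) → toℕ j < k → ∃ λ (i : Fin n) → toℕ i < k × π ⟨$⟩ʳ i ≡ j))

Indecomposable : ∀ {n} → Permutation′ n → Set
Indecomposable π = ¬ Decomposable π

oppositeₚ : ∀ {n} → Permutation′ n
oppositeₚ = permutation opposite opposite opposite-involutive opposite-involutive

-- Reversal R : a_1 ... a_n ↦ a_n ... a_1, i.e. (R π)(j) = π(n+1-j).
reversal : ∀ {n} → Permutation′ n → Permutation′ n
reversal π = oppositeₚ ∘ₚ π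

-- Call a pair of intervals, of positions and of values, a block of σ when σ maps the
-- positions onto the values, and proper when it misses some position.  Bootstrap
-- percolation on the matrix of π never leaves the proper blocks: each 1 is a one-cell
-- block, and a cell infected by two neighbours lies in the interval hull of their
-- blocks, which is again a block because the two blocks touch in both coordinates.
-- The hull fails to be proper only if it contains every position; then the block
-- through the value 1 contains the first or the last position (otherwise the other
-- block contains both, hence everything), and a proper block through the value 1 and
-- the first (last) position is a decomposition of π (of R π).  So if π is full, its
-- bottom-left corner forces π or R π to decompose.  Finally π and R π never both
-- decompose: if π fixes [1,k] and R π fixes [1,j], then k ≤ j would put position 1
-- among the last j positions and j < k would put position n inside [1,k].
module Submission where

open import Defs
open import Data.Nat using (ℕ; zero; suc; _≤_; _<_; z≤n; s≤s; _∸_; _⊓_; _⊔_; _≤?_; _<?_)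
open import Data.Nat.Properties
open import Data.Fin using (Fin; toℕ; fromℕ<; inject≤; opposite) renaming (zero to fzero; suc to fsuc)
open import Data.Fin.Properties
  using (toℕ-injective; toℕ<n; toℕ-fromℕ<; toℕ-inject≤; inject≤-injective; fromℕ<-injective;
         injective⇒≤; toℕ≤pred[n]; opposite-prop; opposite-involutive; all?; ¬∀⟶∃¬)
open import Data.Fin.Permutation using (Permutation′; _⟨$⟩ʳ_; _⟨$⟩ˡ_; inverseˡ; inverseʳ; flip)
open import Data.Product using (_×_; _,_; Σ; ∃; proj₂)
open import Data.Sum using (_⊎_; inj₁; inj₂; [_,_]′; swap; fromInj₂)
open import Function using (_∘_)
open import Function.Bundles using (Injection)
open import Function.Definitions using (Injective)
open import Function.Properties.Inverse using (↔⇒↣)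
open import Relation.Nullary using (¬_; Dec; yes; no; contradiction)
open import Relation.Nullary.Decidable using (_×-dec_)
open import Relation.Binary.PropositionalEquality
  using (_≡_; _≢_; refl; sym; trans; cong; subst; module ≡-Reasoning)

private
  variable
    m n : ℕ

record Interval : Set where
  constructor [_,_⟩
  field
    lo hi : ℕ
open Interval

infix 4 _∈_ _∈?_
infixl 6 _∪_

_∈_ : ℕ → Interval → Set
x ∈ I = lo I ≤ x × x < hi I

_∈?_ : ∀ x I → Dec (x ∈ I)
x ∈? I = lo I ≤? x ×-dec x <? hi I

∈-convex : ∀ {I a b x} → a ∈ I → b ∈ I → a ≤ x → x ≤ b → x ∈ I
∈-convex (lo≤a , _) (_ , b<hi) a≤x x≤b = ≤-trans lo≤a a≤x , ≤-<-trans x≤b b<hi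

singleton : ℕ → Interval
singleton x = [ x , suc x ⟩

∈-singleton : ∀ x → x ∈ singleton x
∈-singleton x = ≤-refl , ≤-refl

singleton-∈ : ∀ {i c : Fin n} → toℕ i ∈ singleton (toℕ c) → i ≡ c
singleton-∈ (c≤i , s≤s i≤c) = toℕ-injective (≤-antisym i≤c c≤i)

_∪_ : Interval → Interval → Interval
I ∪ J = [ lo I ⊓ lo J , hi I ⊔ hi J ⟩

∈-∪ˡ : ∀ {I} J {x} → x ∈ I → x ∈ I ∪ J
∈-∪ˡ {I} J (lo≤x , x<hi) =
  ≤-trans (m⊓n≤m (lo I) (lo J)) lo≤x , <-≤-trans x<hi (m≤m⊔n (hi I) (hi J))

∈-∪ʳ : ∀ I {J x} → x ∈ J → x ∈ I ∪ J
∈-∪ʳ I {J} (lo≤x , x<hi) =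
  ≤-trans (m⊓n≤n (lo I) (lo J)) lo≤x , <-≤-trans x<hi (m≤n⊔m (hi I) (hi J))

Touching : Interval → Interval → Set
Touching I J = lo J ≤ hi I × lo I ≤ hi J

touching : ∀ {I J a b} → a ∈ I → b ∈ J → a ≤ suc b → b ≤ suc a → Touching I J
touching (lo≤a , a<hi) (lo′≤b , b<hi′) a≤1+b b≤1+a =
  ≤-trans lo′≤b (≤-trans b≤1+a a<hi) , ≤-trans lo≤a (≤-trans a≤1+b b<hi′)

touching-common : ∀ {I J a} → a ∈ I → a ∈ J → Touching I J
touching-common {a = a} a∈I a∈J = touching a∈I a∈J (n≤1+n a) (n≤1+n a)

Near : ℕ → ℕ → Set
Near a b = suc a ≡ b ⊎ suc b ≡ a

touching-near : ∀ {I J a b} → a ∈ I → b ∈ J → Near a b → Touching I J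
touching-near {a = a} a∈I b∈J (inj₁ refl) = touching a∈I b∈J (m≤n⇒m≤1+n (n≤1+n a)) ≤-refl
touching-near {b = b} a∈I b∈J (inj₂ refl) = touching a∈I b∈J ≤-refl (m≤n⇒m≤1+n (n≤1+n b))

∈-between-neighbours : ∀ {I a b x} → a ∈ I → b ∈ I → Near a x → Near b x → a ≢ b → x ∈ I
∈-between-neighbours a∈I b∈I (inj₁ refl) (inj₂ refl) _   = ∈-convex a∈I b∈I (n≤1+n _) (n≤1+n _)
∈-between-neighbours a∈I b∈I (inj₂ refl) (inj₁ refl) _   = ∈-convex b∈I a∈I (n≤1+n _) (n≤1+n _)
∈-between-neighbours _   _   (inj₁ refl) (inj₁ e)    a≢b = contradiction (sym (suc-injective e)) a≢b
∈-between-neighbours _   _   (inj₂ refl) (inj₂ e)    a≢b = contradiction e a≢b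

<⊔⇒< : ∀ {x a b} → x < a ⊔ b → a ≤ x → x < b
<⊔⇒< {x} {a} {b} x<a⊔b a≤x with ≤-total a b
... | inj₁ a≤b = subst (x <_) (m≤n⇒m⊔n≡n a≤b) x<a⊔b
... | inj₂ b≤a = contradiction (subst (x <_) (m≥n⇒m⊔n≡m b≤a) x<a⊔b) (≤⇒≯ a≤x)

⊓≤⇒≤ : ∀ {x a b} → a ⊓ b ≤ x → x < a → b ≤ x
⊓≤⇒≤ {x} {a} {b} a⊓b≤x x<a with ≤-total a b
... | inj₁ a≤b = contradiction (subst (_≤ x) (m≤n⇒m⊓n≡m a≤b) a⊓b≤x) (<⇒≱ x<a)
... | inj₂ b≤a = subst (_≤ x) (m≥n⇒m⊓n≡n b≤a) a⊓b≤x

∪-split : ∀ {I J x} → Touching I J → x ∈ I ∪ J → x ∈ I ⊎ x ∈ J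
∪-split {I} {J} {x} (loJ≤hiI , loI≤hiJ) (lo≤x , x<hi) with lo I ≤? x | x <? hi I
... | yes loI≤x | yes x<hiI = inj₁ (loI≤x , x<hiI)
... | yes _     | no x≮hiI  = inj₂ (≤-trans loJ≤hiI (≮⇒≥ x≮hiI) , <⊔⇒< x<hi (≮⇒≥ x≮hiI))
... | no loI≰x  | _         = inj₂ (⊓≤⇒≤ lo≤x (≰⇒> loI≰x) , <-≤-trans (≰⇒> loI≰x) loI≤hiJ)

-- The image of an interval under opposite : Fin n → Fin n; truncation of n ∸ hi is
-- harmless because only elements of Fin n are ever tested for membership.
mirror : ℕ → Interval → Interval
mirror n I = [ n ∸ hi I , n ∸ lo I ⟩

opposite-∈-mirror : ∀ {I} (i : Fin n) → toℕ i ∈ I → toℕ (opposite i) ∈ mirror n I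
opposite-∈-mirror {n} i (lo≤i , i<hi) rewrite opposite-prop i =
  ∸-monoʳ-≤ n i<hi , ∸-monoʳ-< (s≤s lo≤i) (toℕ<n i)

mirror-∈⇒opposite-∈ : ∀ {I} (i : Fin n) → toℕ i ∈ mirror n I → toℕ (opposite i) ∈ I
mirror-∈⇒opposite-∈ {n} {I} i (n∸hi≤i , i<n∸lo) rewrite opposite-prop i =
  ∸-cancelʳ-≤ (<⇒≤ lo<n) (subst (_≤ n ∸ lo I) (sym n∸[n∸1+i]≡1+i) i<n∸lo) ,
  ∸-cancelʳ-< (subst (n ∸ hi I <_) (sym n∸[n∸1+i]≡1+i) (s≤s n∸hi≤i))
  where
  n∸[n∸1+i]≡1+i : n ∸ (n ∸ suc (toℕ i)) ≡ suc (toℕ i)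
  n∸[n∸1+i]≡1+i = m∸[m∸n]≡n (toℕ<n i)
  lo<n : lo I < n
  lo<n = m∸n≢0⇒n<m (>⇒≢ (≤-<-trans z≤n i<n∸lo))

last∈⇒0∈mirror : ∀ {I} → m ∈ I → 0 ∈ mirror (suc m) I
last∈⇒0∈mirror (lo≤m , m<hi) = ≤-reflexive (m≤n⇒m∸n≡0 m<hi) , m<n⇒0<n∸m (s≤s lo≤m)

⟨$⟩ʳ-injective : (σ : Permutation′ n) → Injective _≡_ _≡_ (σ ⟨$⟩ʳ_)
⟨$⟩ʳ-injective σ = Injection.injective (↔⇒↣ σ)

prefix-maps⇒≤ : ∀ {p q} (σ : Permutation′ n) →
  (∀ i → toℕ i < p → toℕ (σ ⟨$⟩ʳ i) < q) → p ⊓ n ≤ q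
prefix-maps⇒≤ {n} {p} {q} σ maps = injective⇒≤ {f = restrict} restrict-injective
  where
  embed : Fin (p ⊓ n) → Fin n
  embed k = inject≤ k (m⊓n≤n p n)
  embed<p : ∀ k → toℕ (embed k) < p
  embed<p k = subst (_< p) (sym (toℕ-inject≤ k _)) (<-≤-trans (toℕ<n k) (m⊓n≤m p n))
  image<q : ∀ k → toℕ (σ ⟨$⟩ʳ embed k) < q
  image<q k = maps (embed k) (embed<p k)
  restrict : Fin (p ⊓ n) → Fin q
  restrict k = fromℕ< (image<q k)
  restrict-injective : Injective _≡_ _≡_ restrict
  restrict-injective {k} {l} eq = inject≤-injective _ _ k l
    (⟨$⟩ʳ-injective σ (toℕ-injective (fromℕ<-injective _ _ (image<q k) (image<q l) eq)))

record Block {n} (σ : Permutation′ n) : Set where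
  field
    cols vals : Interval
    cols→vals : ∀ i → toℕ i ∈ cols → toℕ (σ ⟨$⟩ʳ i) ∈ vals
    vals→cols : ∀ j → toℕ j ∈ vals → toℕ (σ ⟨$⟩ˡ j) ∈ cols
open Block

Proper : {σ : Permutation′ n} → Block σ → Set
Proper {n} B = ∃ λ (i : Fin n) → ¬ toℕ i ∈ cols B

-- Points are cells (v , c) indexed by value and column; a 1 of σ sits at (σ c , c).
infix 4 _∈ᴮ_
_∈ᴮ_ : {σ : Permutation′ n} → Cell n → Block σ → Set
(v , c) ∈ᴮ B = toℕ c ∈ cols B × toℕ v ∈ vals B

∈-cols⇒∈-vals : {σ : Permutation′ n} {j : Fin n} (B : Block σ) →
  toℕ (σ ⟨$⟩ˡ j) ∈ cols B → toℕ j ∈ vals B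
∈-cols⇒∈-vals {σ = σ} B h = subst (_∈ vals B) (cong toℕ (inverseʳ σ)) (cols→vals B _ h)

single : (σ : Permutation′ n) → Fin n → Block σ
single σ c = record
  { cols      = singleton (toℕ c)
  ; vals      = singleton (toℕ (σ ⟨$⟩ʳ c))
  ; cols→vals = λ i i∈ →
      subst (λ i → toℕ (σ ⟨$⟩ʳ i) ∈ _) (sym (singleton-∈ i∈)) (∈-singleton _)
  ; vals→cols = λ j j∈ → subst (λ j → toℕ (σ ⟨$⟩ˡ j) ∈ _) (sym (singleton-∈ j∈))
      (subst (λ i → toℕ i ∈ _) (sym (inverseˡ σ)) (∈-singleton _))
  }

single-proper : {σ : Permutation′ (suc (suc m))} (c : Fin (suc (suc m))) → Proper (single σ c)
single-proper fzero    = fsuc fzero , λ { (_ , s≤s ()) }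
single-proper (fsuc c) = fzero , λ { (() , _) }

merge : {σ : Permutation′ n} (B₁ B₂ : Block σ) →
  Touching (cols B₁) (cols B₂) → Touching (vals B₁) (vals B₂) → Block σ
merge B₁ B₂ tc tv = record
  { cols      = cols B₁ ∪ cols B₂
  ; vals      = vals B₁ ∪ vals B₂
  ; cols→vals = λ i →
      [ ∈-∪ˡ (vals B₂) ∘ cols→vals B₁ i , ∈-∪ʳ (vals B₁) ∘ cols→vals B₂ i ]′ ∘ ∪-split tc
  ; vals→cols = λ j →
      [ ∈-∪ˡ (cols B₂) ∘ vals→cols B₁ j , ∈-∪ʳ (cols B₁) ∘ vals→cols B₂ j ]′ ∘ ∪-split tv
  }

reverse : {σ : Permutation′ n} → Block σ → Block (reversal σ)
reverse {n} {σ} B = record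
  { cols      = mirror n (cols B)
  ; vals      = vals B
  ; cols→vals = λ i → cols→vals B (opposite i) ∘ mirror-∈⇒opposite-∈ i
  ; vals→cols = λ j → opposite-∈-mirror (σ ⟨$⟩ˡ j) ∘ vals→cols B j
  }

reverse-proper : {σ : Permutation′ n} (B : Block σ) → Proper B → Proper (reverse B)
reverse-proper B (i , i∉) = opposite i , λ i∈ →
  i∉ (subst (_∈ cols B) (cong toℕ (opposite-involutive i)) (mirror-∈⇒opposite-∈ (opposite i) i∈))

corner-block⇒decomposable : {σ : Permutation′ n} (B : Block σ) →
  Proper B → 0 ∈ cols B → 0 ∈ vals B → Decomposable σ
corner-block⇒decomposable {n} {σ} B (i , i∉) (lo≤0 , 0<p) (lo′≤0 , _) = p , 0<p , p<n , maps , onto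
  where
  p = hi (cols B)
  q = hi (vals B)
  col∈ : ∀ {x} → x < p → x ∈ cols B
  col∈ x<p = ≤-trans lo≤0 z≤n , x<p
  val∈ : ∀ {x} → x < q → x ∈ vals B
  val∈ x<q = ≤-trans lo′≤0 z≤n , x<q
  p<n : p < n
  p<n = ≤-<-trans (≮⇒≥ (i∉ ∘ col∈)) (toℕ<n i)
  p≤q : p ≤ q
  p≤q = subst (_≤ q) (m≤n⇒m⊓n≡m (<⇒≤ p<n))
          (prefix-maps⇒≤ σ (λ i → proj₂ ∘ cols→vals B i ∘ col∈))
  q⊓n≤p : q ⊓ n ≤ p
  q⊓n≤p = prefix-maps⇒≤ (flip σ) (λ j → proj₂ ∘ vals→cols B j ∘ val∈)
  maps : ∀ i → toℕ i < p → toℕ (σ ⟨$⟩ʳ i) < p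
  maps i i<p = <-≤-trans (⊓-glb (proj₂ (cols→vals B i (col∈ i<p))) (toℕ<n _)) q⊓n≤p
  onto : ∀ j → toℕ j < p → ∃ λ i → toℕ i < p × σ ⟨$⟩ʳ i ≡ j
  onto j j<p = σ ⟨$⟩ˡ j , proj₂ (vals→cols B j (val∈ (<-≤-trans j<p p≤q))) , inverseʳ σ

EitherDecomposable : Permutation′ n → Set
EitherDecomposable σ = Decomposable σ ⊎ Decomposable (reversal σ)

zero-value-block⇒decomposable : {σ : Permutation′ (suc m)} (B B′ : Block σ) →
  Proper B → Proper B′ → (∀ (i : Fin (suc m)) → toℕ i ∈ cols B ⊎ toℕ i ∈ cols B′) →
  0 ∈ vals B → EitherDecomposable σ
zero-value-block⇒decomposable {m} B B′ pB (k , k∉) cover 0∈vals with 0 ∈? cols B | m ∈? cols B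
... | yes 0∈ | _     = inj₁ (corner-block⇒decomposable B pB 0∈ 0∈vals)
... | no _   | yes m∈ =
  inj₂ (corner-block⇒decomposable (reverse B) (reverse-proper B pB) (last∈⇒0∈mirror m∈) 0∈vals)
... | no 0∉  | no m∉ =
  contradiction (∈-convex (in-B′ z≤n 0∉) (in-B′ ≤-refl m∉) z≤n (toℕ≤pred[n] k)) k∉
  where
  in-B′ : ∀ {x} → x ≤ m → ¬ x ∈ cols B → x ∈ cols B′
  in-B′ {x} x≤m x∉B = fromInj₂ (λ x∈B → contradiction x∈B x∉B)
    (subst (λ x → x ∈ cols B ⊎ x ∈ cols B′) (toℕ-fromℕ< (s≤s x≤m)) (cover (fromℕ< (s≤s x≤m))))

covering⇒decomposable : {σ : Permutation′ n} {B₁ B₂ : Block σ} → Proper B₁ → Proper B₂ →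
  (∀ (i : Fin n) → toℕ i ∈ cols B₁ ⊎ toℕ i ∈ cols B₂) → EitherDecomposable σ
covering⇒decomposable {n = zero} (() , _)
covering⇒decomposable {n = suc m} {σ = σ} {B₁} {B₂} p₁ p₂ cover with cover (σ ⟨$⟩ˡ fzero)
... | inj₁ h =
  zero-value-block⇒decomposable B₁ B₂ p₁ p₂ cover (∈-cols⇒∈-vals {j = fzero} B₁ h)
... | inj₂ h =
  zero-value-block⇒decomposable B₂ B₁ p₂ p₁ (swap ∘ cover) (∈-cols⇒∈-vals {j = fzero} B₂ h)

-- Row r of the permutation matrix holds the value n − 1 − r.
point : Cell n → Cell n
point (r , c) = opposite r , c

point-involutive : (x : Cell n) → point (point x) ≡ x
point-involutive (r , c) = cong (_, c) (opposite-involutive r)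

point-injective : {x y : Cell n} → point x ≡ point y → x ≡ y
point-injective {x = x} {y} eq =
  trans (sym (point-involutive x)) (trans (cong point eq) (point-involutive y))

suc-opposite : {r r′ : Fin n} →
  suc (toℕ r) ≡ toℕ r′ → suc (toℕ (opposite r′)) ≡ toℕ (opposite r)
suc-opposite {n} {r} {r′} 1+r≡r′ = begin
  suc (toℕ (opposite r′))  ≡⟨ cong suc (opposite-prop r′) ⟩
  suc (n ∸ suc (toℕ r′))   ≡⟨ sym (+-∸-assoc 1 (toℕ<n r′)) ⟩
  n ∸ toℕ r′               ≡⟨ cong (n ∸_) (sym 1+r≡r′) ⟩
  n ∸ suc (toℕ r)          ≡⟨ sym (opposite-prop r) ⟩
  toℕ (opposite r)         ∎
  where open ≡-Reasoning

near-opposite : {r r′ : Fin n} →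
  Near (toℕ r) (toℕ r′) → Near (toℕ (opposite r)) (toℕ (opposite r′))
near-opposite (inj₁ 1+r≡r′) = inj₂ (suc-opposite 1+r≡r′)
near-opposite (inj₂ 1+r′≡r) = inj₁ (suc-opposite 1+r′≡r)

adjacent-point : {x y : Cell n} → Adjacent x y → Adjacent (point x) (point y)
adjacent-point (inj₁ (r≡r′ , near)) = inj₁ (cong opposite r≡r′ , near)
adjacent-point (inj₂ (c≡c′ , near)) = inj₂ (c≡c′ , near-opposite near)

Covered : Permutation′ n → Cell n → Set
Covered σ x = Σ (Block σ) λ B → Proper B × x ∈ᴮ B

record Joined {n} {σ : Permutation′ n} (x : Cell n) (B₁ B₂ : Block σ) : Set where
  constructor joined
  field
    hull   : Block σ
    x∈hull : x ∈ᴮ hull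
    hull⊆  : ∀ (i : Fin n) → toℕ i ∈ cols hull → toℕ i ∈ cols B₁ ⊎ toℕ i ∈ cols B₂

joined-swap : {σ : Permutation′ n} {x : Cell n} {B₁ B₂ : Block σ} →
  Joined x B₁ B₂ → Joined x B₂ B₁
joined-swap (joined B x∈B cover) = joined B x∈B λ i → swap ∘ cover i

merge-joined : {σ : Permutation′ n} {v c : Fin n} {B₁ B₂ : Block σ} →
  (tc : Touching (cols B₁) (cols B₂)) (tv : Touching (vals B₁) (vals B₂)) →
  toℕ c ∈ cols B₁ ∪ cols B₂ → toℕ v ∈ vals B₁ ∪ vals B₂ → Joined (v , c) B₁ B₂
merge-joined {B₁ = B₁} {B₂} tc tv c∈ v∈ = joined (merge B₁ B₂ tc tv) (c∈ , v∈) λ _ → ∪-split tc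

joined-same-value : {σ : Permutation′ n} {v c cy cz : Fin n} {B₁ B₂ : Block σ} →
  Near (toℕ cy) (toℕ c) → Near (toℕ cz) (toℕ c) → cy ≢ cz →
  (v , cy) ∈ᴮ B₁ → (v , cz) ∈ᴮ B₂ → Joined (v , c) B₁ B₂
joined-same-value {v = v} {c} {B₁ = B₁} {B₂} ny nz cy≢cz (cy∈ , v∈₁) (cz∈ , v∈₂) =
  merge-joined
    (touching-common (vals→cols B₁ v v∈₁) (vals→cols B₂ v v∈₂))
    (touching-common v∈₁ v∈₂)
    (∈-between-neighbours (∈-∪ˡ (cols B₂) cy∈) (∈-∪ʳ (cols B₁) cz∈) ny nz
      (cy≢cz ∘ toℕ-injective))
    (∈-∪ˡ (vals B₂) v∈₁)

joined-same-column : {σ : Permutation′ n} {v c vy vz : Fin n} {B₁ B₂ : Block σ} →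
  Near (toℕ vy) (toℕ v) → Near (toℕ vz) (toℕ v) → vy ≢ vz →
  (vy , c) ∈ᴮ B₁ → (vz , c) ∈ᴮ B₂ → Joined (v , c) B₁ B₂
joined-same-column {v = v} {c} {B₁ = B₁} {B₂} ny nz vy≢vz (c∈₁ , vy∈) (c∈₂ , vz∈) =
  merge-joined
    (touching-common c∈₁ c∈₂)
    (touching-common (cols→vals B₁ c c∈₁) (cols→vals B₂ c c∈₂))
    (∈-∪ˡ (cols B₂) c∈₁)
    (∈-between-neighbours (∈-∪ˡ (vals B₂) vy∈) (∈-∪ʳ (vals B₁) vz∈) ny nz
      (vy≢vz ∘ toℕ-injective))

joined-corner : {σ : Permutation′ n} {v c cy vz : Fin n} {B₁ B₂ : Block σ} →
  Near (toℕ cy) (toℕ c) → Near (toℕ vz) (toℕ v) →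
  (v , cy) ∈ᴮ B₁ → (vz , c) ∈ᴮ B₂ → Joined (v , c) B₁ B₂
joined-corner {v = v} {c} {B₁ = B₁} {B₂} ny nz (cy∈ , v∈) (c∈ , vz∈) =
  merge-joined (touching-near cy∈ c∈ ny) (touching-near v∈ vz∈ (swap nz))
    (∈-∪ʳ (cols B₁) c∈) (∈-∪ˡ (vals B₂) v∈)

adjacent⇒joined : {σ : Permutation′ n} {x y z : Cell n} {B₁ B₂ : Block σ} →
  Adjacent y x → Adjacent z x → y ≢ z → y ∈ᴮ B₁ → z ∈ᴮ B₂ → Joined x B₁ B₂
adjacent⇒joined {x = v , c} {_ , cy} {_ , cz} (inj₁ (refl , ny)) (inj₁ (refl , nz)) y≢z =
  joined-same-value {v = v} {c} {cy} {cz} ny nz (y≢z ∘ cong (v ,_))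
adjacent⇒joined {x = v , c} {vy , _} {vz , _} (inj₂ (refl , ny)) (inj₂ (refl , nz)) y≢z =
  joined-same-column {v = v} {c} {vy} {vz} ny nz (y≢z ∘ cong (_, c))
adjacent⇒joined {x = v , c} {_ , cy} {vz , _} (inj₁ (refl , ny)) (inj₂ (refl , nz)) _ =
  joined-corner {v = v} {c} {cy} {vz} ny nz
adjacent⇒joined {x = v , c} {vy , _} {_ , cz} (inj₂ (refl , ny)) (inj₁ (refl , nz)) _ y∈ z∈ =
  joined-swap (joined-corner {v = v} {c} {cz} {vy} nz ny z∈ y∈)

joined⇒covered : {σ : Permutation′ n} {x : Cell n} {B₁ B₂ : Block σ} →
  Proper B₁ → Proper B₂ → Joined x B₁ B₂ → Covered σ x ⊎ EitherDecomposable σ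
joined⇒covered {B₁ = B₁} {B₂} p₁ p₂ (joined B x∈B cover)
  with all? (λ i → toℕ i ∈? cols B)
... | yes all∈ =
  inj₂ (covering⇒decomposable {B₁ = B₁} {B₂} p₁ p₂ (λ i → cover i (all∈ i)))
... | no ¬all∈ = inj₁ (B , ¬∀⟶∃¬ _ _ (λ i → toℕ i ∈? cols B) ¬all∈ , x∈B)

infected⇒covered : {π : Permutation′ (suc (suc m))} {x : Cell (suc (suc m))} →
  Infected π x → Covered π (point x) ⊎ EitherDecomposable π
infected⇒covered {π = π} (initial {r , c} refl) =
  inj₁ (single π c , single-proper {σ = π} c , ∈-singleton _ ,
        subst (_∈ singleton (toℕ (π ⟨$⟩ʳ c))) (cong toℕ (sym (opposite-involutive _))) (∈-singleton _))
infected⇒covered (spread {x} {y} {z} y~x z~x y≢z y-inf z-inf)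
  with infected⇒covered y-inf | infected⇒covered z-inf
... | inj₂ d  | _      = inj₂ d
... | inj₁ _  | inj₂ d = inj₂ d
... | inj₁ (B₁ , p₁ , y∈) | inj₁ (B₂ , p₂ , z∈) =
  joined⇒covered p₁ p₂ (adjacent⇒joined {x = point x} {point y} {point z} {B₁ = B₁} {B₂}
    (adjacent-point y~x) (adjacent-point z~x) (y≢z ∘ point-injective) y∈ z∈)

full⇒decomposable : {π : Permutation′ (suc (suc m))} → Full π → EitherDecomposable π
full⇒decomposable full with infected⇒covered (full (opposite fzero , fzero))
... | inj₁ (B , proper , 0∈cols , v∈vals) =
  inj₁ (corner-block⇒decomposable B proper 0∈cols
          (subst (_∈ vals B) (cong toℕ (opposite-involutive fzero)) v∈vals))
... | inj₂ d = d

below-preimage : (σ : Permutation′ n) {k : ℕ} →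
  (∀ j → toℕ j < k → ∃ λ i → toℕ i < k × σ ⟨$⟩ʳ i ≡ j) →
  ∀ i → toℕ (σ ⟨$⟩ʳ i) < k → toℕ i < k
below-preimage σ {k} onto i σi<k with onto (σ ⟨$⟩ʳ i) σi<k
... | i′ , i′<k , σi′≡σi = subst (λ t → toℕ t < k) (⟨$⟩ʳ-injective σ σi′≡σi) i′<k

last≮ : ∀ {k} → k < suc m → ¬ toℕ (opposite (fzero {m})) < k
last≮ {m} (s≤s k≤m) m<k = <⇒≱ (subst (_< _) (opposite-prop (fzero {m})) m<k) k≤m

decomposable⇒reversal-indecomposable : (σ : Permutation′ n) →
  Decomposable σ → Indecomposable (reversal σ)
decomposable⇒reversal-indecomposable {suc m} σ
  (k , 1≤k , k<n , maps , onto) (j , 1≤j , j<n , maps′ , onto′) with k ≤? j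
... | yes k≤j = last≮ j<n (below-preimage (reversal σ) onto′ (opposite fzero)
                  (subst (λ t → toℕ (σ ⟨$⟩ʳ t) < j) (sym (opposite-involutive fzero))
                    (<-≤-trans (maps fzero 1≤k) k≤j)))
... | no k≰j  = last≮ k<n (below-preimage σ onto (opposite fzero)
                  (<-trans (maps′ fzero 1≤j) (≰⇒> k≰j)))

theorem4p5 : ∀ (n : ℕ) → 2 ≤ n → ∀ (π : Permutation′ n) → Full π →
    (Indecomposable π → Decomposable (reversal π)) ×
    (Decomposable π → Indecomposable (reversal π))
theorem4p5 (suc zero)    (s≤s ())
theorem4p5 (suc (suc m)) _ π full =
  (λ indecomposable → fromInj₂ (λ d → contradiction d indecomposable) (full⇒decomposable full)) ,
  decomposable⇒reversal-indecomposable π
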